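{- Let $S:\mathsf{Type}$ and $P:S\to\mathsf{Type}$ be a family of propositions. There is an equivalence of containers $\partial(S\triangleleft P)\simeq(\sum_{s:S}P(s)\triangleleft 0)$. In particular $\partial\,\mathrm{Id}\simeq\mathrm{K}(1)$ and $\partial\,\mathrm{K}(A)\simeq\mathrm{K}(0)$ for all $A:\mathsf{Type}$.
   Context: Work in Homotopy Type Theory with a univalent universe. A point $a:A$ is isolated if $a=b$ is decidable for all $b:A$; $A^{\circ}$ is the subtype of isolated points and $A\setminus a:=\sum_{b:A}\neg(a=b)$. A container $(S\triangleleft P)$ has shapes $S$ and positions $P:S\to\mathsf{Type}$. A cartesian morphism $(S\triangleleft P)\multimap(T\triangleleft Q)$ is $(f,u)$ with $f:S\to T$, $u:\prod_sQ_{fs}\simeq P_s$; an equivalence of containers is one with $f$ an equivalence. The derivative is $\partial(S\triangleleft P):=((s,p):\sum_s(P_s)^{\circ}\triangleleft P_s\setminus p)$. The identity container is $\mathrm{Id}:=(1\triangleleft 1)$ and the constant container at $A$ is $\mathrm{K}(A):=(A\triangleleft 0)$. -}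

module Defs where

open import Level using (Level; _⊔_)
open import Data.Product using (Σ; Σ-syntax; _,_)
open import Data.Unit.Polymorphic using (⊤)
open import Data.Empty.Polymorphic using (⊥)
open import Relation.Nullary using (¬_; Dec)
open import Relation.Binary.PropositionalEquality using (_≡_)
open import Data.Container.Core using (Container; _▷_; Shape; Position) public
open import Function.Properties.Inverse.HalfAdjointEquivalence using (_≃_) public

private variable ℓ ℓ' ℓ'' : Level

isIsolated : {A : Set ℓ} → A → Set ℓ
isIsolated {A = A} a = (b : A) → Dec (a ≡ b)

_° : Set ℓ → Set ℓ
A ° = Σ[ a ∈ A ] isIsolated a

_∖_ : (A : Set ℓ) → A → Set ℓ
A ∖ a = Σ[ b ∈ A ] ¬ (a ≡ b)

record Cartesian {s p t q : Level} (F : Container s p) (G : Container t q)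
       : Set (s ⊔ p ⊔ t ⊔ q) where
  constructor cartesian
  field
    shape : Shape F → Shape G
    pos   : (x : Shape F) → Position G (shape x) ≃ Position F x

record ContainerEquiv {s p t q : Level} (F : Container s p) (G : Container t q)
       : Set (s ⊔ p ⊔ t ⊔ q) where
  constructor container-equiv
  field
    morphism    : Cartesian F G
    shape-equiv : Σ[ e ∈ (Shape F ≃ Shape G) ] ((x : Shape F) → _≃_.to e x ≡ Cartesian.shape morphism x)

∂ : {s p : Level} → Container s p → Container (s ⊔ p) p
∂ (S ▷ P) = (Σ[ x ∈ S ] (P x) °) ▷ λ { (x , (p , _)) → P x ∖ p }

Id : (ℓ : Level) → Container ℓ ℓ
Id ℓ = ⊤ ▷ λ _ → ⊤

K : {ℓ : Level} → Set ℓ → Container ℓ ℓ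
K A = A ▷ λ _ → ⊥

isProp : Set ℓ → Set ℓ
isProp A = (x y : A) → x ≡ y

-- In a proposition every point is isolated, and uniquely so: by function
-- extensionality it suffices that each decision `a ≟ b` is `yes`, and `Dec`
-- of a proposition with a `yes` is contractible because propositions are sets.
-- Hence the shapes of ∂ (S ▷ P) are just Σ S P, while every position set
-- P s ∖ p is empty because P s has no point other than p.
module Submission where

open import Defs
open import Level using (Level)
open import Data.Product using (Σ; _×_; _,_; proj₁)
open import Data.Product.Function.Dependent.Propositional using (congˡ)
open import Data.Unit.Polymorphic using (⊤)
open import Data.Empty.Polymorphic using (⊥)
open import Axiom.Extensionality.Propositional using (Extensionality)
open import Axiom.UniquenessOfIdentityProofs using (UIP; module Constant⇒UIP)
open import Relation.Nullary using (¬_; yes; contradiction)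
open import Relation.Nullary.Decidable using (dec-yes-irr)
open import Relation.Binary.PropositionalEquality using (_≡_; refl; sym; cong)
open import Function.Bundles using (_↔_; mk↔ₛ′)
open import Function.Properties.Inverse using (↔-refl; ↔-trans)
open import Function.Properties.Inverse.HalfAdjointEquivalence using (↔⇒≃)
open import Function.Related.TypeIsomorphisms using (×-identityˡ; ×-zeroʳ)

private variable ℓ : Level

isProp⇒UIP : {A : Set ℓ} → isProp A → UIP A
isProp⇒UIP isProp-A = Constant⇒UIP.≡-irrelevant (λ {x} {y} _ → isProp-A x y) (λ _ _ → refl)

isProp⇒isIsolated : {A : Set ℓ} → isProp A → (a : A) → isIsolated a
isProp⇒isIsolated isProp-A a b = yes (isProp-A a b)

isProp⇒isIsolated-unique : Extensionality ℓ ℓ → {A : Set ℓ} → (isProp-A : isProp A) →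
                           {a : A} (i : isIsolated a) → isProp⇒isIsolated isProp-A a ≡ i
isProp⇒isIsolated-unique ext isProp-A {a} i =
  ext λ b → sym (dec-yes-irr (i b) (isProp⇒UIP isProp-A) (isProp-A a b))

isProp⇒°↔ : Extensionality ℓ ℓ → {A : Set ℓ} → isProp A → A ° ↔ A
isProp⇒°↔ ext isProp-A = mk↔ₛ′ proj₁ (λ a → a , isProp⇒isIsolated isProp-A a) (λ _ → refl)
  λ { (a , i) → cong (a ,_) (isProp⇒isIsolated-unique ext isProp-A i) }

isProp⇒∖-empty : {A : Set ℓ} → isProp A → (a : A) → ¬ (A ∖ a)
isProp⇒∖-empty isProp-A a (b , a≢b) = a≢b (isProp-A a b)

∂-shape-prop↔ : Extensionality ℓ ℓ → (S : Set ℓ) (P : S → Set ℓ) → ((x : S) → isProp (P x)) →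
                Shape (∂ (S ▷ P)) ↔ Σ S P
∂-shape-prop↔ ext S P isProp-P = congˡ λ {x} → isProp⇒°↔ ext (isProp-P x)

positions-empty⇒≃K : {F : Container ℓ ℓ} {A : Set ℓ} → Shape F ↔ A →
                     ((s : Shape F) → ¬ Position F s) → ContainerEquiv F (K A)
positions-empty⇒≃K {F = F} {A} shape↔ empty =
  container-equiv (cartesian (_≃_.to shape≃) λ s → ¬⇒⊥≃ (empty s)) (shape≃ , λ _ → refl)
  where
  shape≃ : Shape F ≃ A
  shape≃ = ↔⇒≃ shape↔
  ¬⇒⊥≃ : ∀ {B : Set ℓ} → ¬ B → ⊥ {ℓ} ≃ B
  ¬⇒⊥≃ ¬B = ↔⇒≃ (mk↔ₛ′ (λ ()) (λ b → contradiction b ¬B) (λ b → contradiction b ¬B) λ ())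

∂-prop≃K : Extensionality ℓ ℓ → (S : Set ℓ) (P : S → Set ℓ) → ((x : S) → isProp (P x)) →
           {A : Set ℓ} → Σ S P ↔ A → ContainerEquiv (∂ (S ▷ P)) (K A)
∂-prop≃K ext S P isProp-P ΣSP↔A =
  positions-empty⇒≃K (↔-trans (∂-shape-prop↔ ext S P isProp-P) ΣSP↔A)
                     λ { (x , p , _) → isProp⇒∖-empty (isProp-P x) p }

proposition3p13 : {ℓ : Level} → Extensionality ℓ ℓ →
    ((S : Set ℓ) (P : S → Set ℓ) → ((x : S) → isProp (P x)) →
      ContainerEquiv (∂ (S ▷ P)) (Σ S P ▷ λ _ → ⊥ {ℓ}))
    × ContainerEquiv (∂ (Id ℓ)) (K (⊤ {ℓ}))
    × ((A : Set ℓ) → ContainerEquiv (∂ (K A)) (K (⊥ {ℓ})))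
proposition3p13 {ℓ} ext =
    (λ S P isProp-P → ∂-prop≃K ext S P isProp-P ↔-refl)
  , ∂-prop≃K ext ⊤ (λ _ → ⊤) (λ _ _ _ → refl) (×-identityˡ ℓ ⊤)
  , λ A → ∂-prop≃K ext A (λ _ → ⊥) (λ _ ()) (×-zeroʳ ℓ A)
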